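{- Let $G$ be a graph and $\Phi$ a forest of $G$, and let $e_1<e_2<\cdots<e_h$ be an orientation and ordering of the edges not in $\Phi$, with $e_1=\overrightarrow{vu}$. Let $\beta$ be the edge ordering map with data $e_1<e_2<\cdots<e_h$ and $\beta'$ the edge ordering map with data $\overline{e}_1<e_2<\cdots<e_h$, where $\overline{e}_1$ denotes $e_1$ with reversed orientation. Then the two bijections give isomorphic $\operatorname{Pic}^0(G)$-torsors with translating element $[\partial(e_1)]=[(u)-(v)]\in\operatorname{Pic}^0(G)$; that is, for every spanning tree $T$ of $G$, $\beta(T)-\beta'(T)$ is linearly equivalent to $(u)-(v)$.
   Context: Graphs are finite and connected, possibly with parallel edges but without loops; cycles are simple. A divisor is a function $V(G)\to\mathbb{Z}$, written as a formal sum of vertices. The Laplacian $\Delta=D-A$ ($D$ the diagonal degree matrix, $A$ the adjacency matrix counting parallel edges); principal divisors are $\Delta\mathbf{u}$ for $\mathbf{u}\in\mathbb{Z}^{V}$; two divisors are linearly equivalent if their difference is principal; $\operatorname{Pic}^0(G)$ is the group of degree-0 divisors modulo principal divisors. For a directed edge $\overrightarrow{vu}$, $\partial(\overrightarrow{vu})=(u)-(v)$. Edge ordering map with data $e_1<\cdots<e_h$ (oriented, ordered edges outside a forest): orient every cycle so that it traverses its smallest $e_i$ in the given direction; send a spanning tree $T$ to the divisor obtained by orienting each $f\notin T$ as it is traversed by the so-oriented unique cycle in $T+f$ and placing a chip at the head of $f$. Edge ordering maps are bijections from spanning trees to break divisors, and a bijection $\beta$ to divisor classes makes the set of spanning trees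 a $\operatorname{Pic}^0(G)$-torsor; two such bijections $\beta,\beta'$ give isomorphic torsors with translating element $[D_0]$ if $[\beta(T)]=[D_0]+[\beta'(T)]$ for all $T$. -}

module Defs where

open import Data.Nat as ℕ using (ℕ; zero; suc)
open import Data.Integer as ℤ using (ℤ; +_; _-_; _*_)
import Data.Fin
open import Data.Fin using (Fin; _≟_; _<_)
open import Data.Bool using (Bool; true; false; not; if_then_else_)
open import Data.Product using (Σ; ∃; _×_; _,_; proj₁; proj₂)
open import Data.Sum using (_⊎_)
open import Data.Empty using (⊥)
open import Data.Unit using (⊤)
open import Data.List using (List; []; _∷_; map; length; lookup)
open import Data.List.Relation.Unary.All using (All)
open import Data.List.Relation.Binary.Pointwise using ()
open import Data.List.Relation.Unary.Unique.Propositional using (Unique)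
open import Data.List.Membership.Propositional using (_∈_; _∉_)
open import Relation.Binary.PropositionalEquality using (_≡_; _≢_)
open import Relation.Nullary using (¬_)
open import Relation.Nullary.Decidable using (⌊_⌋)
open import Function using (_∘_; _⇔_)

Σℤ : ∀ {k} → (Fin k → ℤ) → ℤ
Σℤ {zero}  f = + 0
Σℤ {suc k} f = f Data.Fin.zero ℤ.+ Σℤ (f ∘ Data.Fin.suc)

[_≟ᶠ_] : ∀ {k} → Fin k → Fin k → ℤ
[ a ≟ᶠ b ] = if ⌊ a ≟ b ⌋ then + 1 else + 0

_-ᴰ_ : {V : Set} → (V → ℤ) → (V → ℤ) → (V → ℤ)
(D₁ -ᴰ D₂) x = D₁ x - D₂ x

-- Multigraphs without loops: vertices Fin n, edges Fin m,
-- each edge e has endpoints src e ≠ tgt e (parallel edges allowed).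

record Graph : Set where
  field
    n      : ℕ
    m      : ℕ
    src    : Fin m → Fin n
    tgt    : Fin m → Fin n
    noLoop : ∀ e → src e ≢ tgt e

module _ (G : Graph) where
  open Graph G

  Vertex : Set
  Vertex = Fin n

  Edge : Set
  Edge = Fin m

  -- an oriented edge: (e , true) goes src e → tgt e, (e , false) goes tgt e → src e
  OEdge : Set
  OEdge = Edge × Bool

  edgeOf : OEdge → Edge
  edgeOf = proj₁

  tailO : OEdge → Vertex
  tailO (e , true)  = src e
  tailO (e , false) = tgt e

  headO : OEdge → Vertex
  headO (e , true)  = tgt e
  headO (e , false) = src e

  rev : OEdge → OEdge
  rev (e , b) = (e , not b)

  Chain : Vertex → List OEdge → Vertex → Set
  Chain x []       y = x ≡ y
  Chain x (o ∷ os) y = tailO o ≡ x × Chain (headO o) os y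

  EdgeSet : Set₁
  EdgeSet = Edge → Set

  Connected : EdgeSet → Set
  Connected P = ∀ x y → ∃ λ ws → Chain x ws y × All (P ∘ edgeOf) ws

  IsCycle : EdgeSet → List OEdge → Set
  IsCycle P []       = ⊥
  IsCycle P (o ∷ os) =
    Chain (tailO o) (o ∷ os) (tailO o) ×
    All (P ∘ edgeOf) (o ∷ os) ×
    Unique (map edgeOf (o ∷ os)) ×
    Unique (map tailO (o ∷ os))

  Acyclic : EdgeSet → Set
  Acyclic P = ∀ C → ¬ IsCycle P C

  Sub : Set
  Sub = Edge → Bool

  ⟦_⟧ : Sub → EdgeSet
  ⟦ S ⟧ e = S e ≡ true

  IsForest : Sub → Set
  IsForest Φ = Acyclic ⟦ Φ ⟧

  IsSpanningTree : Sub → Set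
  IsSpanningTree T = Connected ⟦ T ⟧ × Acyclic ⟦ T ⟧

  -- L = e₁ < e₂ < ... < e_h : an orientation and ordering of the edges not in Φ
  IsOrderingData : Sub → List OEdge → Set
  IsOrderingData Φ L =
    Unique (map edgeOf L) × (∀ e → (e ∈ map edgeOf L) ⇔ (Φ e ≡ false))

  -- the cycle C traverses its smallest e_i (w.r.t. L) in the direction of e_i
  OrientedByData : List OEdge → List OEdge → Set
  OrientedByData L C =
    Σ (Fin (length L)) λ i →
      lookup L i ∈ C × (∀ j → j < i → edgeOf (lookup L j) ∉ map edgeOf C)

  plus : Sub → Edge → EdgeSet
  plus T f e = T e ≡ true ⊎ e ≡ f

  -- o : Edge → Bool is the orientation of the edges f ∉ T produced by the
  -- edge ordering map with data L: the unique cycle in T + f, oriented so that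
  -- it traverses its smallest e_i in the given direction, traverses f as (f , o f).
  IsEdgeOrderingOrientation : List OEdge → Sub → (Edge → Bool) → Set
  IsEdgeOrderingOrientation L T o =
    ∀ f → T f ≡ false →
      ∃ λ C → IsCycle (plus T f) C × (f , o f) ∈ C × OrientedByData L C

  Divisor : Set
  Divisor = Vertex → ℤ

  chipDivisor : Sub → (Edge → Bool) → Divisor
  chipDivisor T o x =
    Σℤ λ f → if T f then + 0 else [ headO (f , o f) ≟ᶠ x ]

  pt : Vertex → Divisor
  pt a x = [ a ≟ᶠ x ]


  degree : Vertex → ℤ
  degree x = Σℤ λ e → [ src e ≟ᶠ x ] ℤ.+ [ tgt e ≟ᶠ x ]

  adj : Vertex → Vertex → ℤ
  adj x y = Σℤ λ e → ([ src e ≟ᶠ x ] * [ tgt e ≟ᶠ y ]) ℤ.+ ([ src e ≟ᶠ y ] * [ tgt e ≟ᶠ x ])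

  Δ : (Vertex → ℤ) → Divisor
  Δ u x = degree x * u x - Σℤ (λ y → adj x y * u y)

  IsPrincipal : Divisor → Set
  IsPrincipal D = ∃ λ (u : Vertex → ℤ) → ∀ x → D x ≡ Δ u x

  LinEquiv : Divisor → Divisor → Set
  LinEquiv D₁ D₂ = IsPrincipal (D₁ -ᴰ D₂)

module Submission where

-- Write e₁ = (ε , b).  For a spanning tree T, the orientations o and o′ chosen
-- by the two data differ exactly on the non-tree edges f whose fundamental
-- cycle uses ε: such a cycle contains (ε , b) resp. (ε , not b), so it is
-- traversed in opposite directions, while a cycle avoiding ε is oriented by
-- the same later datum under both.  Hence β(T) − β′(T) is the sum of
-- ∂(f , o f) over those f.  If ε ∉ T, the only such f is ε, giving ∂e₁.  If
-- ε ∈ T, those f form the fundamental cut of ε, and with the potential v of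
-- e₁ (the net number of times the tree path from a vertex to a root
-- traverses e₁) one gets β(T) − β′(T) − ∂e₁ = Δ v.

import Algebra.Properties.CommutativeSemigroup as CSemigroup
open import Data.Bool using (Bool; true; false; not; if_then_else_) renaming (_≟_ to _≟ᵇ_)
open import Data.Bool.Properties using (not-involutive; ¬-not)
open import Data.Empty using (⊥; ⊥-elim)
open import Data.Fin as F using (Fin; _≟_)
open import Data.Fin.Properties using (suc-injective; <-cmp)
open import Data.Integer using (ℤ; +_; _-_; _*_; -_; _+_)
import Data.Integer.Properties as ℤP
open import Algebra.Properties.AbelianGroup ℤP.+-0-abelianGroup using (inverseʳ-unique)
open import Data.Integer.Tactic.RingSolver using (solve-∀)
open import Data.List using (List; []; _∷_; _++_; map; length; lookup)
open import Data.List.Membership.Propositional using (_∈_; _∉_)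
open import Data.List.Membership.Propositional.Properties using (∈-map⁺; ∈-map⁻; ∈-∃++)
open import Data.List.Properties using (length-++; length-++-≤ʳ)
open import Data.List.Relation.Unary.All as All using (All; []; _∷_)
open import Data.List.Relation.Unary.All.Properties using (All¬⇒¬Any; ¬Any⇒All¬; ++⁺; ++⁻ˡ; ++⁻ʳ)
open import Data.List.Relation.Unary.AllPairs using ([]; _∷_)
open import Data.List.Relation.Unary.Any using (here; there; any?)
open import Data.List.Relation.Unary.Unique.Propositional using (Unique)
open import Data.Nat as ℕ using (ℕ; zero; suc; s≤s; z≤n)
import Data.Nat.Properties as ℕP
open import Data.Product using (Σ; ∃; _×_; _,_; proj₁; proj₂)
open import Data.Sum using (_⊎_; inj₁; inj₂)
open import Data.Unit using (⊤)
open import Defs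
open import Function using (_∘_)
open import Relation.Binary.Definitions using (tri<; tri≈; tri>)
open import Relation.Binary.PropositionalEquality
open import Relation.Nullary using (yes; no)

ind-refl : ∀ {k} (a : Fin k) → [ a ≟ᶠ a ] ≡ + 1
ind-refl a with a ≟ a
... | yes _ = refl
... | no a≢a = ⊥-elim (a≢a refl)

ind-neq : ∀ {k} {a b : Fin k} → a ≢ b → [ a ≟ᶠ b ] ≡ + 0
ind-neq {a = a} {b} a≢b with a ≟ b
... | yes a≡b = ⊥-elim (a≢b a≡b)
... | no _ = refl

ind-subst : ∀ {k} (a x : Fin k) (w : Fin k → ℤ) → [ a ≟ᶠ x ] * w x ≡ [ a ≟ᶠ x ] * w a
ind-subst a x w with a ≟ x
... | yes refl = refl
... | no _ = refl

Σ-cong : ∀ {k} {f g : Fin k → ℤ} → (∀ i → f i ≡ g i) → Σℤ f ≡ Σℤ g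
Σ-cong {zero} f≗g = refl
Σ-cong {suc k} f≗g = cong₂ _+_ (f≗g F.zero) (Σ-cong (f≗g ∘ F.suc))

Σ-+ : ∀ {k} (f g : Fin k → ℤ) → Σℤ (λ i → f i + g i) ≡ Σℤ f + Σℤ g
Σ-+ {zero} f g = refl
Σ-+ {suc k} f g = trans (cong (_+_ (f F.zero + g F.zero)) (Σ-+ (f ∘ F.suc) (g ∘ F.suc)))
  (CSemigroup.interchange ℤP.+-commutativeSemigroup (f F.zero) (g F.zero) _ _)

Σ-neg : ∀ {k} (f : Fin k → ℤ) → Σℤ (λ i → - f i) ≡ - Σℤ f
Σ-neg {zero} f = refl
Σ-neg {suc k} f = trans (cong (_+_ (- f F.zero)) (Σ-neg (f ∘ F.suc))) (sym (ℤP.neg-distrib-+ (f F.zero) _))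

Σ-- : ∀ {k} (f g : Fin k → ℤ) → Σℤ (λ i → f i - g i) ≡ Σℤ f - Σℤ g
Σ-- f g = trans (Σ-+ f (λ i → - g i)) (cong (_+_ (Σℤ f)) (Σ-neg g))

Σ-*ʳ : ∀ {k} (f : Fin k → ℤ) c → Σℤ (λ i → f i * c) ≡ Σℤ f * c
Σ-*ʳ {zero} f c = refl
Σ-*ʳ {suc k} f c = trans (cong (_+_ (f F.zero * c)) (Σ-*ʳ (f ∘ F.suc) c)) (sym (ℤP.*-distribʳ-+ c (f F.zero) _))

Σ-*ˡ : ∀ {k} c (f : Fin k → ℤ) → Σℤ (λ i → c * f i) ≡ c * Σℤ f
Σ-*ˡ c f = trans (Σ-cong (λ i → ℤP.*-comm c (f i))) (trans (Σ-*ʳ f c) (ℤP.*-comm _ c))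

Σ-zero : ∀ {k} (f : Fin k → ℤ) → (∀ i → f i ≡ + 0) → Σℤ f ≡ + 0
Σ-zero {zero} f f≗0 = refl
Σ-zero {suc k} f f≗0 = cong₂ _+_ (f≗0 F.zero) (Σ-zero (f ∘ F.suc) (f≗0 ∘ F.suc))

Σ-single : ∀ {k} (a : Fin k) (f : Fin k → ℤ) → (∀ i → i ≢ a → f i ≡ + 0) → Σℤ f ≡ f a
Σ-single F.zero f off = trans (cong (_+_ (f F.zero)) (Σ-zero (f ∘ F.suc) (λ i → off (F.suc i) λ ()))) (ℤP.+-identityʳ _)
Σ-single (F.suc a) f off = trans (cong (_+ Σℤ (f ∘ F.suc)) (off F.zero λ ()))
  (trans (ℤP.+-identityˡ _) (Σ-single a (f ∘ F.suc) (λ i i≢a → off (F.suc i) (i≢a ∘ suc-injective))))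

Σ-delta : ∀ {k} (a : Fin k) (c : Fin k → ℤ) → Σℤ (λ y → [ a ≟ᶠ y ] * c y) ≡ c a
Σ-delta a c = trans (Σ-single a _ (λ i i≢a → cong (_* c i) (ind-neq (i≢a ∘ sym))))
  (trans (cong (_* c a) (ind-refl a)) (ℤP.*-identityˡ _))

Σ-swap : ∀ {k l} (f : Fin k → Fin l → ℤ) → Σℤ (λ i → Σℤ (f i)) ≡ Σℤ (λ j → Σℤ (λ i → f i j))
Σ-swap {zero} {l} f = sym (Σ-zero {l} _ (λ _ → refl))
Σ-swap {suc k} f = trans (cong (_+_ (Σℤ (f F.zero))) (Σ-swap (f ∘ F.suc))) (sym (Σ-+ (f F.zero) _))

-- This turns
-- linear equivalence into an edge-by-edge verification.

incidence : (G : Graph) → Edge G → Vertex G → ℤ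
incidence G e x = [ Graph.src G e ≟ᶠ x ] - [ Graph.tgt G e ≟ᶠ x ]

Δ-as-edge-sum : (G : Graph) (v : Vertex G → ℤ) (x : Vertex G) →
  Δ G v x ≡ Σℤ (λ e → incidence G e x * (v (Graph.src G e) - v (Graph.tgt G e)))
Δ-as-edge-sum G v x = begin
  degree G x * v x - Σℤ (λ y → adj G x y * v y)
    ≡⟨ cong₂ _-_ (sym (Σ-*ʳ (λ e → [ src e ≟ᶠ x ] + [ tgt e ≟ᶠ x ]) (v x)))
                 (trans (Σ-cong (λ y → sym (Σ-*ʳ (λ e → adjacency e y) (v y))))
                        (Σ-swap (λ y e → adjacency e y * v y))) ⟩
  Σℤ (λ e → ([ src e ≟ᶠ x ] + [ tgt e ≟ᶠ x ]) * v x) - Σℤ (λ e → Σℤ (λ y → adjacency e y * v y))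
    ≡⟨ cong₂ _-_ (Σ-cong diagonal) (Σ-cong off-diagonal) ⟩
  Σℤ (λ e → [ src e ≟ᶠ x ] * v (src e) + [ tgt e ≟ᶠ x ] * v (tgt e))
    - Σℤ (λ e → [ src e ≟ᶠ x ] * v (tgt e) + [ tgt e ≟ᶠ x ] * v (src e))
    ≡⟨ sym (Σ-- {m} _ _) ⟩
  Σℤ (λ e → ([ src e ≟ᶠ x ] * v (src e) + [ tgt e ≟ᶠ x ] * v (tgt e))
            - ([ src e ≟ᶠ x ] * v (tgt e) + [ tgt e ≟ᶠ x ] * v (src e)))
    ≡⟨ Σ-cong (λ e → factor [ src e ≟ᶠ x ] [ tgt e ≟ᶠ x ] (v (src e)) (v (tgt e))) ⟩
  Σℤ (λ e → incidence G e x * (v (src e) - v (tgt e))) ∎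
  where
  open Graph G
  open ≡-Reasoning

  adjacency : Edge G → Vertex G → ℤ
  adjacency e y = [ src e ≟ᶠ x ] * [ tgt e ≟ᶠ y ] + [ src e ≟ᶠ y ] * [ tgt e ≟ᶠ x ]

  diagonal : ∀ e → ([ src e ≟ᶠ x ] + [ tgt e ≟ᶠ x ]) * v x
                 ≡ [ src e ≟ᶠ x ] * v (src e) + [ tgt e ≟ᶠ x ] * v (tgt e)
  diagonal e = trans (ℤP.*-distribʳ-+ (v x) [ src e ≟ᶠ x ] _)
    (cong₂ _+_ (ind-subst (src e) x v) (ind-subst (tgt e) x v))

  off-diagonal : ∀ e → Σℤ (λ y → adjacency e y * v y)
                     ≡ [ src e ≟ᶠ x ] * v (tgt e) + [ tgt e ≟ᶠ x ] * v (src e)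
  off-diagonal e = begin
    Σℤ (λ y → adjacency e y * v y)
      ≡⟨ Σ-cong (λ y → expand [ src e ≟ᶠ x ] [ tgt e ≟ᶠ y ] [ src e ≟ᶠ y ] [ tgt e ≟ᶠ x ] (v y)) ⟩
    Σℤ (λ y → [ src e ≟ᶠ x ] * ([ tgt e ≟ᶠ y ] * v y) + [ tgt e ≟ᶠ x ] * ([ src e ≟ᶠ y ] * v y))
      ≡⟨ Σ-+ {n} _ _ ⟩
    Σℤ (λ y → [ src e ≟ᶠ x ] * ([ tgt e ≟ᶠ y ] * v y)) + Σℤ (λ y → [ tgt e ≟ᶠ x ] * ([ src e ≟ᶠ y ] * v y))
      ≡⟨ cong₂ _+_ (trans (Σ-*ˡ [ src e ≟ᶠ x ] (λ y → [ tgt e ≟ᶠ y ] * v y)) (cong ([ src e ≟ᶠ x ] *_) (Σ-delta (tgt e) v)))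
                   (trans (Σ-*ˡ [ tgt e ≟ᶠ x ] (λ y → [ src e ≟ᶠ y ] * v y)) (cong ([ tgt e ≟ᶠ x ] *_) (Σ-delta (src e) v))) ⟩
    [ src e ≟ᶠ x ] * v (tgt e) + [ tgt e ≟ᶠ x ] * v (src e) ∎
    where
    expand : ∀ a b c d w → (a * b + c * d) * w ≡ a * (b * w) + d * (c * w)
    expand = solve-∀

  factor : ∀ a b p q → (a * p + b * q) - (a * q + b * p) ≡ (a - b) * (p - q)
  factor = solve-∀

sumOver : {A : Set} → (A → ℤ) → List A → ℤ
sumOver ψ [] = + 0
sumOver ψ (x ∷ xs) = ψ x + sumOver ψ xs

module _ {A : Set} where

  sumOver-++ : ∀ (ψ : A → ℤ) xs ys → sumOver ψ (xs ++ ys) ≡ sumOver ψ xs + sumOver ψ ys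
  sumOver-++ ψ [] ys = sym (ℤP.+-identityˡ _)
  sumOver-++ ψ (x ∷ xs) ys = trans (cong (_+_ (ψ x)) (sumOver-++ ψ xs ys)) (sym (ℤP.+-assoc (ψ x) _ _))

  sumOver-+ : ∀ (ψ χ : A → ℤ) xs → sumOver (λ a → ψ a + χ a) xs ≡ sumOver ψ xs + sumOver χ xs
  sumOver-+ ψ χ [] = refl
  sumOver-+ ψ χ (x ∷ xs) = trans (cong (_+_ (ψ x + χ x)) (sumOver-+ ψ χ xs))
    (CSemigroup.interchange ℤP.+-commutativeSemigroup (ψ x) (χ x) _ _)

  sumOver-neg : ∀ (ψ : A → ℤ) xs → sumOver (λ a → - ψ a) xs ≡ - sumOver ψ xs
  sumOver-neg ψ [] = refl
  sumOver-neg ψ (x ∷ xs) = trans (cong (_+_ (- ψ x)) (sumOver-neg ψ xs)) (sym (ℤP.neg-distrib-+ (ψ x) _))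

  sumOver-congᴬ : ∀ {ψ χ : A → ℤ} {xs} → All (λ a → ψ a ≡ χ a) xs → sumOver ψ xs ≡ sumOver χ xs
  sumOver-congᴬ [] = refl
  sumOver-congᴬ (p ∷ ps) = cong₂ _+_ p (sumOver-congᴬ ps)

  module _ {N} (key : A → Fin N) (ψ : A → ℤ) (k : Fin N) (ψ-off : ∀ a → key a ≢ k → ψ a ≡ + 0) where

    sumOver-absent : ∀ xs → k ∉ map key xs → sumOver ψ xs ≡ + 0
    sumOver-absent [] _ = refl
    sumOver-absent (x ∷ xs) k∉ =
      cong₂ _+_ (ψ-off x (k∉ ∘ here ∘ sym)) (sumOver-absent xs (k∉ ∘ there))

    sumOver-present : ∀ xs → Unique (map key xs) → ∀ {a} → a ∈ xs → key a ≡ k → sumOver ψ xs ≡ ψ a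
    sumOver-present (x ∷ xs) (x∉xs ∷ _) (here refl) refl =
      trans (cong (_+_ (ψ x)) (sumOver-absent xs (All¬⇒¬Any x∉xs))) (ℤP.+-identityʳ _)
    sumOver-present (x ∷ xs) (x∉xs ∷ u) (there a∈xs) refl =
      trans (cong₂ _+_ (ψ-off x (λ kx≡ka → All¬⇒¬Any x∉xs (subst (_∈ map key xs) (sym kx≡ka) (∈-map⁺ key a∈xs))))
                       (sumOver-present xs u a∈xs refl))
            (ℤP.+-identityˡ _)

  unique-key : ∀ {N} (key : A → Fin N) xs → Unique (map key xs) →
    ∀ {a b} → a ∈ xs → b ∈ xs → key a ≡ key b → a ≡ b
  unique-key key (x ∷ xs) (_ ∷ _) (here refl) (here refl) _ = refl
  unique-key key (x ∷ xs) (x∉xs ∷ _) (here refl) (there b∈xs) ka≡kb =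
    ⊥-elim (All¬⇒¬Any x∉xs (subst (_∈ map key xs) (sym ka≡kb) (∈-map⁺ key b∈xs)))
  unique-key key (x ∷ xs) (x∉xs ∷ _) (there a∈xs) (here refl) ka≡kb =
    ⊥-elim (All¬⇒¬Any x∉xs (subst (_∈ map key xs) ka≡kb (∈-map⁺ key a∈xs)))
  unique-key key (x ∷ xs) (_ ∷ u) (there a∈xs) (there b∈xs) ka≡kb = unique-key key xs u a∈xs b∈xs ka≡kb

  Repeat : ∀ {N} → (A → Fin N) → List A → Set
  Repeat key xs = Σ (List A) λ as → Σ A λ b → Σ (List A) λ bs → Σ A λ b′ → Σ (List A) λ cs →
                    xs ≡ as ++ b ∷ bs ++ b′ ∷ cs × key b ≡ key b′

  unique-or-repeat : ∀ {N} (key : A → Fin N) xs → Unique (map key xs) ⊎ Repeat key xs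
  unique-or-repeat key [] = inj₁ []
  unique-or-repeat key (x ∷ xs) with any? (key x ≟_) (map key xs)
  ... | yes kx∈ with ∈-map⁻ key kx∈
  ...   | y , y∈xs , kx≡ky with ∈-∃++ y∈xs
  ...     | bs , cs , refl = inj₂ ([] , x , bs , y , cs , refl , kx≡ky)
  unique-or-repeat key (x ∷ xs) | no kx∉ with unique-or-repeat key xs
  ... | inj₁ u = inj₁ (¬Any⇒All¬ _ kx∉ ∷ u)
  ... | inj₂ (as , b , bs , b′ , cs , refl , kb≡kb′) = inj₂ (x ∷ as , b , bs , b′ , cs , refl , kb≡kb′)

  module _ (b : A) (bs : List A) (b′ : A) (cs : List A) where

    loop-shorter : ∀ as → suc (length (b ∷ bs)) ℕ.≤ length (as ++ b ∷ bs ++ b′ ∷ cs)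
    loop-shorter [] = s≤s (ℕP.≤-trans (ℕP.m<m+n (length bs) (s≤s z≤n)) (ℕP.≤-reflexive (sym (length-++ bs))))
    loop-shorter (a ∷ as) = ℕP.m≤n⇒m≤1+n (loop-shorter as)

    remainder-shorter : ∀ as → suc (length (as ++ b′ ∷ cs)) ℕ.≤ length (as ++ b ∷ bs ++ b′ ∷ cs)
    remainder-shorter [] = s≤s (length-++-≤ʳ (b′ ∷ cs) {bs})
    remainder-shorter (a ∷ as) = s≤s (remainder-shorter as)

    between-shorter : ∀ as → suc (length bs) ℕ.≤ length (as ++ b ∷ bs ++ b′ ∷ cs)
    between-shorter as = ℕP.≤-trans (ℕP.n≤1+n _) (loop-shorter as)

    outside-shorter : ∀ as → suc (length (as ++ cs)) ℕ.≤ length (as ++ b ∷ bs ++ b′ ∷ cs)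
    outside-shorter [] = s≤s (ℕP.≤-trans (ℕP.n≤1+n _) (length-++-≤ʳ (b′ ∷ cs) {bs}))
    outside-shorter (a ∷ as) = s≤s (outside-shorter as)

agree : Bool → Bool → ℤ
agree true true = + 1
agree false false = + 1
agree true false = - (+ 1)
agree false true = - (+ 1)

agree-notʳ : ∀ s c → agree s (not c) ≡ - agree s c
agree-notʳ true true = refl
agree-notʳ true false = refl
agree-notʳ false true = refl
agree-notʳ false false = refl

agree-notˡ : ∀ s c → agree (not s) c ≡ - agree s c
agree-notˡ true true = refl
agree-notˡ true false = refl
agree-notˡ false true = refl
agree-notˡ false false = refl

agree-refl : ∀ s → agree s s ≡ + 1
agree-refl true = refl
agree-refl false = refl

module _ (G : Graph) where

  tail-rev : ∀ o → tailO G (rev G o) ≡ headO G o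
  tail-rev (e , true) = refl
  tail-rev (e , false) = refl

  head-rev : ∀ o → headO G (rev G o) ≡ tailO G o
  head-rev (e , true) = refl
  head-rev (e , false) = refl

  rev-≢ : ∀ o → rev G o ≢ o
  rev-≢ (e , true) ()
  rev-≢ (e , false) ()

  same-or-reversed : ∀ a b → edgeOf G a ≡ edgeOf G b → b ≡ a ⊎ b ≡ rev G a
  same-or-reversed (e , true) (.e , true) refl = inj₁ refl
  same-or-reversed (e , true) (.e , false) refl = inj₂ refl
  same-or-reversed (e , false) (.e , true) refl = inj₂ refl
  same-or-reversed (e , false) (.e , false) refl = inj₁ refl

  traversal : OEdge G → OEdge G → ℤ
  traversal (h , s) (e , c) = agree s c * [ e ≟ᶠ h ]

  traversal-rev : ∀ h o → traversal h (rev G o) ≡ - traversal h o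
  traversal-rev (h , s) (e , c) = trans (cong (_* [ e ≟ᶠ h ]) (agree-notʳ s c)) (sym (ℤP.neg-distribˡ-* (agree s c) [ e ≟ᶠ h ]))

  traversal-revʰ : ∀ h o → traversal (rev G h) o ≡ - traversal h o
  traversal-revʰ (h , s) (e , c) = trans (cong (_* [ e ≟ᶠ h ]) (agree-notˡ s c)) (sym (ℤP.neg-distribˡ-* (agree s c) [ e ≟ᶠ h ]))

  traversal-off : ∀ h o → edgeOf G o ≢ edgeOf G h → traversal h o ≡ + 0
  traversal-off (h , s) (e , c) e≢h = trans (cong (agree s c *_) (ind-neq e≢h)) (ℤP.*-zeroʳ (agree s c))

  traversal-self : ∀ h → traversal h h ≡ + 1
  traversal-self (h , s) = cong₂ _*_ (agree-refl s) (ind-refl h)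

  cycle-edges-in : ∀ {P} C → IsCycle G P C → All (P ∘ edgeOf G) C
  cycle-edges-in (_ ∷ _) (_ , inP , _ , _) = inP

  cycle-edges-distinct : ∀ {P} C → IsCycle G P C → Unique (map (edgeOf G) C)
  cycle-edges-distinct (_ ∷ _) (_ , _ , distinct , _) = distinct

  cycle-closed : ∀ {P} C → IsCycle G P C → ∃ λ x → Chain G x C x
  cycle-closed (o ∷ _) (walk , _) = tailO G o , walk

  chain-split : ∀ {x z} as {bs} → Chain G x (as ++ bs) z → ∃ λ y → Chain G x as y × Chain G y bs z
  chain-split [] walk = _ , refl , walk
  chain-split (a ∷ as) (a-starts , walk) with chain-split as walk
  ... | y , first , second = y , (a-starts , first) , second

  chain-join : ∀ {x y z} {as bs} → Chain G x as y → Chain G y bs z → Chain G x (as ++ bs) z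
  chain-join {as = []} refl second = second
  chain-join {as = a ∷ as} (a-starts , first) second = a-starts , chain-join first second

  -- By induction on the length: a closed
  -- walk with a repeated vertex splits into two shorter closed walks; one
  -- using an edge in both directions leaves two shorter closed walks once
  -- the two uses are cut out; and one with neither repetition is a cycle.
  module _ (P : EdgeSet G) (P-acyclic : Acyclic G P) (h : OEdge G) where

    private
      τ : List (OEdge G) → ℤ
      τ = sumOver (traversal h)

      InP : List (OEdge G) → Set
      InP = All (P ∘ edgeOf G)

    BalancedUpTo : ℕ → Set
    BalancedUpTo k = ∀ W → length W ℕ.≤ k → ∀ x → Chain G x W x → InP W → τ W ≡ + 0

    split-at-repeated-vertex : ∀ {k} → BalancedUpTo k → ∀ as b bs b′ cs → tailO G b ≡ tailO G b′ →
      length (as ++ b ∷ bs ++ b′ ∷ cs) ℕ.≤ suc k → ∀ x →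
      Chain G x (as ++ b ∷ bs ++ b′ ∷ cs) x → InP (as ++ b ∷ bs ++ b′ ∷ cs) →
      τ (as ++ b ∷ bs ++ b′ ∷ cs) ≡ + 0
    split-at-repeated-vertex bal as b bs b′ cs same-tail len x walk inP
      with chain-split as walk
    ... | _ , to-b , (b-starts , from-b) with chain-split bs from-b
    ... | _ , along-bs , (b′-starts , after-b′) = begin
      τ (as ++ (b ∷ bs) ++ (b′ ∷ cs))       ≡⟨ sumOver-++ (traversal h) as _ ⟩
      τ as + τ ((b ∷ bs) ++ (b′ ∷ cs))      ≡⟨ cong (_+_ (τ as)) (sumOver-++ (traversal h) (b ∷ bs) _) ⟩
      τ as + (τ (b ∷ bs) + τ (b′ ∷ cs))     ≡⟨ CSemigroup.x∙yz≈y∙xz ℤP.+-commutativeSemigroup (τ as) (τ (b ∷ bs)) (τ (b′ ∷ cs)) ⟩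
      τ (b ∷ bs) + (τ as + τ (b′ ∷ cs))     ≡⟨ cong₂ _+_ loop-balanced (trans (sym (sumOver-++ (traversal h) as _)) rest-balanced) ⟩
      + 0                                   ∎
      where
      open ≡-Reasoning
      inP-from-b = ++⁻ʳ as inP
      inP-after-bs = ++⁻ʳ bs (All.tail inP-from-b)

      loop-balanced : τ (b ∷ bs) ≡ + 0
      loop-balanced = bal (b ∷ bs) (ℕP.≤-pred (ℕP.≤-trans (loop-shorter b bs b′ cs as) len)) _
        (refl , subst (Chain G (headO G b) bs) (trans (sym b′-starts) (sym same-tail)) along-bs)
        (All.head inP-from-b ∷ ++⁻ˡ bs (All.tail inP-from-b))

      rest-balanced : τ (as ++ b′ ∷ cs) ≡ + 0
      rest-balanced = bal (as ++ b′ ∷ cs) (ℕP.≤-pred (ℕP.≤-trans (remainder-shorter b bs b′ cs as) len)) x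
        (chain-join to-b (trans (sym same-tail) b-starts , after-b′))
        (++⁺ (++⁻ˡ as inP) inP-after-bs)

    split-at-reversal : ∀ {k} → BalancedUpTo k → ∀ as b bs cs →
      length (as ++ b ∷ bs ++ rev G b ∷ cs) ℕ.≤ suc k → ∀ x →
      Chain G x (as ++ b ∷ bs ++ rev G b ∷ cs) x → InP (as ++ b ∷ bs ++ rev G b ∷ cs) →
      τ (as ++ b ∷ bs ++ rev G b ∷ cs) ≡ + 0
    split-at-reversal bal as b bs cs len x walk inP
      with chain-split as walk
    ... | _ , to-b , (b-starts , from-b) with chain-split bs from-b
    ... | _ , along-bs , (b̄-starts , after-b̄) = begin
      τ (as ++ (b ∷ bs) ++ (rev G b ∷ cs))                         ≡⟨ sumOver-++ (traversal h) as _ ⟩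
      τ as + τ ((b ∷ bs) ++ (rev G b ∷ cs))                        ≡⟨ cong (_+_ (τ as)) (sumOver-++ (traversal h) (b ∷ bs) _) ⟩
      τ as + ((traversal h b + τ bs) + (traversal h (rev G b) + τ cs))
        ≡⟨ cong (λ t → τ as + ((traversal h b + τ bs) + (t + τ cs))) (traversal-rev h b) ⟩
      τ as + ((traversal h b + τ bs) + (- traversal h b + τ cs))   ≡⟨ cancel (τ as) (traversal h b) (τ bs) (τ cs) ⟩
      τ bs + (τ as + τ cs)                                          ≡⟨ cong₂ _+_ between-balanced (trans (sym (sumOver-++ (traversal h) as cs)) outside-balanced) ⟩
      + 0                                                           ∎
      where
      open ≡-Reasoning
      cancel : ∀ a t b c → a + ((t + b) + (- t + c)) ≡ b + (a + c)
      cancel = solve-∀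

      inP-after-b = All.tail (++⁻ʳ as inP)

      between-balanced : τ bs ≡ + 0
      between-balanced = bal bs (ℕP.≤-pred (ℕP.≤-trans (between-shorter b bs (rev G b) cs as) len)) _
        (subst (Chain G (headO G b) bs) (trans (sym b̄-starts) (tail-rev b)) along-bs)
        (++⁻ˡ bs inP-after-b)

      outside-balanced : τ (as ++ cs) ≡ + 0
      outside-balanced = bal (as ++ cs) (ℕP.≤-pred (ℕP.≤-trans (outside-shorter b bs (rev G b) cs as) len)) x
        (chain-join to-b (subst (λ z → Chain G z cs x) (trans (head-rev b) b-starts) after-b̄))
        (++⁺ (++⁻ˡ as inP) (All.tail (++⁻ʳ bs inP-after-b)))

    -- a closed walk with distinct vertices and distinct edges is a cycle
    simple-closed-walk-balanced : ∀ W x → Unique (map (tailO G) W) → Unique (map (edgeOf G) W) →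
      Chain G x W x → InP W → τ W ≡ + 0
    simple-closed-walk-balanced [] _ _ _ _ _ = refl
    simple-closed-walk-balanced (o ∷ os) x distinct-vertices distinct-edges walk inP =
      ⊥-elim (P-acyclic (o ∷ os)
        (subst (λ z → Chain G z (o ∷ os) z) (sym (proj₁ walk)) walk , inP , distinct-edges , distinct-vertices))

    closed-walks-balanced : ∀ k → BalancedUpTo k
    closed-walks-balanced zero [] _ _ _ _ = refl
    closed-walks-balanced (suc k) W len x walk inP with unique-or-repeat (tailO G) W
    ... | inj₂ (as , b , bs , b′ , cs , refl , same-tail) =
      split-at-repeated-vertex (closed-walks-balanced k) as b bs b′ cs same-tail len x walk inP
    ... | inj₁ distinct-vertices with unique-or-repeat (edgeOf G) W
    ...   | inj₁ distinct-edges = simple-closed-walk-balanced W x distinct-vertices distinct-edges walk inP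
    ...   | inj₂ (as , b , bs , b′ , cs , refl , same) with same-or-reversed b b′ same
    ...     | inj₁ refl = split-at-repeated-vertex (closed-walks-balanced k) as b bs b cs refl len x walk inP
    ...     | inj₂ refl = split-at-reversal (closed-walks-balanced k) as b bs cs len x walk inP

tree≢nontree : ∀ {E : Set} (T : E → Bool) {a b} → T a ≡ true → T b ≡ false → a ≢ b
tree≢nontree T a∈T b∉T refl with trans (sym a∈T) b∉T
... | ()

-- As closed
-- tree walks are balanced, every tree walk from a to b traverses h exactly
-- potential h a − potential h b times, so the potential drop along a tree edge
-- is its traversal number, while drops telescope along arbitrary walks.
module Potential (G : Graph) (T : Sub G) (T-tree : IsSpanningTree G T) where

  InT : List (OEdge G) → Set
  InT = All (⟦_⟧ G T ∘ edgeOf G)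

  tree-path : Vertex G → Vertex G → List (OEdge G)
  tree-path x y = proj₁ (proj₁ T-tree x y)

  tree-path-chain : ∀ x y → Chain G x (tree-path x y) y
  tree-path-chain x y = proj₁ (proj₂ (proj₁ T-tree x y))

  tree-path-in-T : ∀ x y → InT (tree-path x y)
  tree-path-in-T x y = proj₂ (proj₂ (proj₁ T-tree x y))

  root : OEdge G → Vertex G
  root h = Graph.src G (edgeOf G h)

  potential : OEdge G → Vertex G → ℤ
  potential h x = sumOver (traversal G h) (tree-path x (root h))

  tree-walk-traversal : ∀ h {a b} W → Chain G a W b → InT W →
    sumOver (traversal G h) W ≡ potential h a - potential h b
  tree-walk-traversal h {a} {b} W walk inT =
    trans (shift (τ R) (τ W) (potential h a) (potential h b))
      (trans (cong₂ (λ s t → s - t + potential h a - potential h b) via-b via-a) (tidy (potential h a) (potential h b)))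
    where
    τ = sumOver (traversal G h)
    R = tree-path (root h) a

    balanced : ∀ W′ → Chain G (root h) W′ (root h) → InT W′ → τ W′ ≡ + 0
    balanced W′ closed inT′ = closed-walks-balanced G (⟦_⟧ G T) (proj₂ T-tree) h (length W′) W′ ℕP.≤-refl _ closed inT′

    via-b : τ R + (τ W + potential h b) ≡ + 0
    via-b = trans (cong (_+_ (τ R)) (sym (sumOver-++ (traversal G h) W _)))
      (trans (sym (sumOver-++ (traversal G h) R _))
        (balanced (R ++ W ++ tree-path b (root h))
          (chain-join G (tree-path-chain _ a) (chain-join G walk (tree-path-chain b _)))
          (++⁺ (tree-path-in-T _ a) (++⁺ inT (tree-path-in-T b _)))))

    via-a : τ R + potential h a ≡ + 0
    via-a = trans (sym (sumOver-++ (traversal G h) R _))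
      (balanced (R ++ tree-path a (root h)) (chain-join G (tree-path-chain _ a) (tree-path-chain a _))
        (++⁺ (tree-path-in-T _ a) (tree-path-in-T a _)))

    shift : ∀ r w p q → w ≡ (r + (w + q)) - (r + p) + p - q
    shift = solve-∀

    tidy : ∀ p q → + 0 - + 0 + p - q ≡ p - q
    tidy = solve-∀

  -- reversing h negates its potential (the root only depends on the edge)
  potential-rev : ∀ h x → potential (rev G h) x ≡ - potential h x
  potential-rev h@(e , c) x = trans (sumOver-congᴬ {xs = tree-path x (root h)} (All.tabulate (λ {o} _ → traversal-revʰ G h o)))
                                   (sumOver-neg (traversal G h) (tree-path x (root h)))

  drop : OEdge G → OEdge G → ℤ
  drop h o = potential h (tailO G o) - potential h (headO G o)

  drop-tree : ∀ h o → T (edgeOf G o) ≡ true → drop h o ≡ traversal G h o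
  drop-tree h o o∈T = sym (trans (sym (ℤP.+-identityʳ _)) (tree-walk-traversal h (o ∷ []) (refl , refl) (o∈T ∷ [])))

  drop-rev : ∀ h o → drop h (rev G o) ≡ - drop h o
  drop-rev h o = trans (cong₂ (λ p q → potential h p - potential h q) (tail-rev G o) (head-rev G o))
    (swap (potential h (tailO G o)) (potential h (headO G o)))
    where
    swap : ∀ p q → q - p ≡ - (p - q)
    swap = solve-∀

  drop-revʰ : ∀ h o → drop (rev G h) o ≡ - drop h o
  drop-revʰ h o = trans (cong₂ _-_ (potential-rev h _) (potential-rev h _)) (negate (potential h _) (potential h _))
    where
    negate : ∀ p q → - p - - q ≡ - (p - q)
    negate = solve-∀

  drop-telescopes : ∀ h {x y} W → Chain G x W y → sumOver (drop h) W ≡ potential h x - potential h y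
  drop-telescopes h {x} [] refl = sym (ℤP.+-inverseʳ (potential h x))
  drop-telescopes h (o ∷ os) (refl , walk) =
    trans (cong (_+_ (drop h o)) (drop-telescopes h os walk)) (collapse (potential h (tailO G o)) _ _)
    where
    collapse : ∀ p q r → (p - q) + (q - r) ≡ p - r
    collapse = solve-∀

-- A cycle in T + f through the non-tree edge f, traversed
-- as (f , d), is determined by (f , d): a tree edge h lies on it, traversed as
-- h, exactly when the potential of h drops by −1 along (f , d).  Hence two such
-- cycles through (f , d) have the same members, and a cycle through (f , not d)
-- consists of the reversed members.
module FundamentalCycle (G : Graph) (T : Sub G) (T-tree : IsSpanningTree G T) where
  open Potential G T T-tree

  record Through (f : Edge G) (d : Bool) (C : List (OEdge G)) : Set where
    field
      f∉T : T f ≡ false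
      is-cycle : IsCycle G (plus G T f) C
      traverses-f : (f , d) ∈ C

  module _ {f d C} (through : Through f d C) where
    open Through through

    edges-in-T+f : All (plus G T f ∘ edgeOf G) C
    edges-in-T+f = cycle-edges-in G C is-cycle

    edges-distinct : Unique (map (edgeOf G) C)
    edges-distinct = cycle-edges-distinct G C is-cycle

    closed : ∃ λ x → Chain G x C x
    closed = cycle-closed G C is-cycle

    -- Around the cycle the drops of potential h cancel; on tree edges they are
    -- traversal numbers, so the drop along (f , d) balances the traversal of h.
    drop-balances-traversal : ∀ h → T (edgeOf G h) ≡ true → sumOver (traversal G h) C + drop h (f , d) ≡ + 0
    drop-balances-traversal h h∈T = begin
      sumOver (traversal G h) C + drop h (f , d)   ≡⟨ cong (_+_ (sumOver (traversal G h) C)) (sym drop-along-f) ⟩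
      sumOver (traversal G h) C + sumOver ψ C      ≡⟨ sym (sumOver-+ (traversal G h) ψ C) ⟩
      sumOver (λ o → traversal G h o + ψ o) C      ≡⟨ sym (sumOver-congᴬ (All.map split edges-in-T+f)) ⟩
      sumOver (drop h) C                           ≡⟨ drop-telescopes h C (proj₂ closed) ⟩
      potential h (proj₁ closed) - potential h (proj₁ closed) ≡⟨ ℤP.+-inverseʳ (potential h (proj₁ closed)) ⟩
      + 0                                          ∎
      where
      open ≡-Reasoning
      ψ : OEdge G → ℤ
      ψ o = [ edgeOf G o ≟ᶠ f ] * drop h o

      ψ-off : ∀ o → edgeOf G o ≢ f → ψ o ≡ + 0
      ψ-off o o≢f = trans (cong (_* drop h o) (ind-neq o≢f)) (ℤP.*-zeroˡ (drop h o))

      drop-along-f : sumOver ψ C ≡ drop h (f , d)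
      drop-along-f = trans (sumOver-present (edgeOf G) ψ f ψ-off C edges-distinct traverses-f refl)
        (trans (cong (_* drop h (f , d)) (ind-refl f)) (ℤP.*-identityˡ _))

      split : ∀ {o} → plus G T f (edgeOf G o) → drop h o ≡ traversal G h o + ψ o
      split {o} (inj₁ o∈T) = trans (drop-tree h o o∈T)
        (sym (trans (cong (_+_ (traversal G h o)) (ψ-off o (tree≢nontree T o∈T f∉T))) (ℤP.+-identityʳ _)))
      split {o} (inj₂ refl) = sym (trans (cong (_+ ψ o) (traversal-off G h o (tree≢nontree T h∈T f∉T ∘ sym)))
        (trans (ℤP.+-identityˡ _) (trans (cong (_* drop h o) (ind-refl f)) (ℤP.*-identityˡ _))))

    drop-from-traversal : ∀ h → T (edgeOf G h) ≡ true → ∀ {t} → sumOver (traversal G h) C ≡ t → drop h (f , d) ≡ - t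
    drop-from-traversal h h∈T {t} τ≡t =
      inverseʳ-unique t _ (trans (cong (_+ drop h (f , d)) (sym τ≡t)) (drop-balances-traversal h h∈T))

    traversal-by-member : ∀ h {o} → o ∈ C → edgeOf G h ≡ edgeOf G o → sumOver (traversal G h) C ≡ traversal G h o
    traversal-by-member h o∈C same =
      sumOver-present (edgeOf G) (traversal G h) (edgeOf G h) (traversal-off G h) C edges-distinct o∈C (sym same)

    data TreeEdgeUse (h : OEdge G) : Set where
      along   : h ∈ C → drop h (f , d) ≡ - (+ 1) → TreeEdgeUse h
      against : rev G h ∈ C → drop h (f , d) ≡ + 1 → TreeEdgeUse h
      unused  : edgeOf G h ∉ map (edgeOf G) C → drop h (f , d) ≡ + 0 → TreeEdgeUse h

    tree-edge-use : ∀ h → T (edgeOf G h) ≡ true → TreeEdgeUse h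
    tree-edge-use h h∈T with any? (edgeOf G h ≟_) (map (edgeOf G) C)
    ... | no h∉C = unused h∉C (drop-from-traversal h h∈T
      (sumOver-absent (edgeOf G) (traversal G h) (edgeOf G h) (traversal-off G h) C h∉C))
    ... | yes h-used with ∈-map⁻ (edgeOf G) h-used
    ...   | o , o∈C , same with same-or-reversed G h o same
    ...     | inj₁ refl = along o∈C (drop-from-traversal h h∈T
      (trans (traversal-by-member h o∈C same) (traversal-self G h)))
    ...     | inj₂ refl = against o∈C (drop-from-traversal h h∈T
      (trans (traversal-by-member h o∈C same) (trans (traversal-rev G h h) (cong -_ (traversal-self G h)))))

  -- The members of any cycle through (f , d), described without the cycle.
  OnCycle : Edge G → Bool → OEdge G → Set
  OnCycle f d o = (T (edgeOf G o) ≡ true × drop o (f , d) ≡ - (+ 1)) ⊎ o ≡ (f , d)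

  module _ {f d C} (through : Through f d C) where
    open Through through

    member⇒OnCycle : ∀ {o} → o ∈ C → OnCycle f d o
    member⇒OnCycle {o} o∈C with All.lookup (edges-in-T+f through) o∈C
    ... | inj₂ o-on-f = inj₂ (unique-key (edgeOf G) C (edges-distinct through) o∈C traverses-f o-on-f)
    ... | inj₁ o∈T with tree-edge-use through o o∈T
    ...   | along _ drop≡-1 = inj₁ (o∈T , drop≡-1)
    ...   | against ō∈C _ = ⊥-elim (rev-≢ G o (unique-key (edgeOf G) C (edges-distinct through) ō∈C o∈C refl))
    ...   | unused o∉C _ = ⊥-elim (o∉C (∈-map⁺ (edgeOf G) o∈C))

    OnCycle⇒member : ∀ {o} → OnCycle f d o → o ∈ C
    OnCycle⇒member (inj₂ refl) = traverses-f
    OnCycle⇒member {o} (inj₁ (o∈T , drop≡-1)) with tree-edge-use through o o∈T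
    ... | along o∈C _ = o∈C
    ... | against _ drop≡1 with trans (sym drop≡-1) drop≡1
    ...   | ()
    OnCycle⇒member {o} (inj₁ (o∈T , drop≡-1)) | unused _ drop≡0 with trans (sym drop≡-1) drop≡0
    ...   | ()

  OnCycle-rev : ∀ {f d} o → OnCycle f d o → OnCycle f (not d) (rev G o)
  OnCycle-rev o (inj₂ refl) = inj₂ refl
  OnCycle-rev {f} {d} o@(e , c) (inj₁ (o∈T , drop≡-1)) = inj₁ (o∈T , (begin
    drop (rev G o) (rev G (f , d))  ≡⟨ drop-rev (rev G o) (f , d) ⟩
    - drop (rev G o) (f , d)        ≡⟨ cong -_ (drop-revʰ o (f , d)) ⟩
    - - drop o (f , d)              ≡⟨ ℤP.neg-involutive _ ⟩
    drop o (f , d)                  ≡⟨ drop≡-1 ⟩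
    - (+ 1)                         ∎))
    where open ≡-Reasoning

  same-direction : ∀ {f d C C′} → Through f d C → Through f d C′ → ∀ {o} → o ∈ C → o ∈ C′
  same-direction through through′ = OnCycle⇒member through′ ∘ member⇒OnCycle through

  opposite-direction : ∀ {f d d′ C C′} → Through f d C → Through f d′ C′ → d′ ≡ not d →
    ∀ {o} → o ∈ C → rev G o ∈ C′
  opposite-direction through through′ refl = OnCycle⇒member through′ ∘ OnCycle-rev _ ∘ member⇒OnCycle through

-- Let C and C′ be cycles in T + f
-- through (f , d) and (f , d′), oriented by the data (ε , b) ∷ rest and
-- (ε , not b) ∷ rest respectively.  If C uses ε, the two data orient it
-- oppositely, so d′ = not d.  Otherwise both data orient it by the same later
-- datum, so d′ = d.
module Reorientation (G : Graph) (T : Sub G) (T-tree : IsSpanningTree G T)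
                     (ε : Edge G) (b : Bool) (rest : List (OEdge G)) where
  open FundamentalCycle G T T-tree

  first-datum-traversed : ∀ c C → ε ∈ map (edgeOf G) C → OrientedByData G ((ε , c) ∷ rest) C → (ε , c) ∈ C
  first-datum-traversed c C ε∈C (F.zero , εc∈C , _) = εc∈C
  first-datum-traversed c C ε∈C (F.suc _ , _ , earlier-unused) = ⊥-elim (earlier-unused F.zero (s≤s z≤n) ε∈C)

  module _ {f d d′ C C′} (through : Through f d C) (through′ : Through f d′ C′)
           (oriented : OrientedByData G ((ε , b) ∷ rest) C)
           (oriented′ : OrientedByData G ((ε , not b) ∷ rest) C′) where

    flipped-if-ε-used : ε ∈ map (edgeOf G) C → d′ ≡ not d
    flipped-if-ε-used ε∈C with d′ ≟ᵇ d
    ... | no d′≢d = ¬-not d′≢d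
    ... | yes d′≡d = ⊥-elim (rev-≢ G (ε , b) (unique-key (edgeOf G) C (edges-distinct through) εb̄∈C εb∈C refl))
      where
      through″ : Through f d C′
      through″ = subst (λ z → Through f z C′) d′≡d through′

      εb∈C : (ε , b) ∈ C
      εb∈C = first-datum-traversed b C ε∈C oriented

      εb̄∈C : (ε , not b) ∈ C
      εb̄∈C = same-direction through″ through
        (first-datum-traversed (not b) C′ (∈-map⁺ (edgeOf G) (same-direction through through″ εb∈C)) oriented′)

    kept-if-ε-unused : ε ∉ map (edgeOf G) C → d′ ≡ d
    kept-if-ε-unused ε∉C with d′ ≟ᵇ d
    ... | yes d′≡d = d′≡d
    ... | no d′≢d = ⊥-elim (compare oriented oriented′)
      where
      to′ : ∀ {o} → o ∈ C → rev G o ∈ C′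
      to′ = opposite-direction through through′ (¬-not d′≢d)

      from′ : ∀ {o} → o ∈ C′ → rev G o ∈ C
      from′ = opposite-direction through′ through (trans (sym (not-involutive d)) (cong not (sym (¬-not d′≢d))))

      -- C′ consists of the reversed edges of C, so the datum orienting C
      -- would have to orient C′ as well, in the same direction
      compare : OrientedByData G ((ε , b) ∷ rest) C → OrientedByData G ((ε , not b) ∷ rest) C′ → ⊥
      compare (F.zero , εb∈C , _) _ = ε∉C (∈-map⁺ (edgeOf G) εb∈C)
      compare _ (F.zero , εb̄∈C′ , _) = ε∉C (∈-map⁺ (edgeOf G) (from′ εb̄∈C′))
      compare (F.suc j , eʲ∈C , earlier-unused) (F.suc j′ , eʲ′∈C′ , earlier-unused′) with <-cmp j j′
      ... | tri< j<j′ _ _ = earlier-unused′ (F.suc j) (s≤s j<j′) (∈-map⁺ (edgeOf G) (to′ eʲ∈C))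
      ... | tri> _ _ j>j′ = earlier-unused (F.suc j′) (s≤s j>j′) (∈-map⁺ (edgeOf G) (from′ eʲ′∈C′))
      ... | tri≈ _ refl _ =
        rev-≢ G (lookup rest j) (unique-key (edgeOf G) C (edges-distinct through) (from′ eʲ′∈C′) eʲ∈C refl)

-- With chip q e x = [ head (e , q e) = x ] for e ∉ T and 0
-- for e ∈ T, the divisor β(T) − β′(T) − ∂e₁ is Σₑ defect e, where
--   defect e = chip o e − chip o′ e − [ e = ε ] · ∂e₁,
-- so it suffices to find v with defect e = ι e · (v(src e) − v(tgt e)) for
-- every edge e.  A non-tree edge whose fundamental cycle uses ε changes its
-- orientation, moving its chip to the other end; all other chips stay put.
-- If ε ∈ T, v is the potential of e₁, which drops by −1 exactly along the
-- (o-oriented) non-tree edges that move.  If ε ∉ T, only the chip on ε moves,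
-- by ∂e₁ itself, and v = 0.
module Translation (G : Graph) (T : Sub G) (T-tree : IsSpanningTree G T)
                   (ε : Edge G) (b : Bool) (rest : List (OEdge G)) (o o′ : Edge G → Bool)
                   (o-def : IsEdgeOrderingOrientation G ((ε , b) ∷ rest) T o)
                   (o′-def : IsEdgeOrderingOrientation G ((ε , not b) ∷ rest) T o′) where
  open Potential G T T-tree
  open FundamentalCycle G T T-tree
  open Reorientation G T T-tree ε b rest
  open ≡-Reasoning

  e₁ : OEdge G
  e₁ = (ε , b)

  ∂e₁ : Vertex G → ℤ
  ∂e₁ x = [ headO G e₁ ≟ᶠ x ] - [ tailO G e₁ ≟ᶠ x ]

  chip : (Edge G → Bool) → Edge G → Vertex G → ℤ
  chip q e x = if T e then + 0 else [ headO G (e , q e) ≟ᶠ x ]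

  H H′ Tl : Edge G → Vertex G → ℤ
  H e x = [ headO G (e , o e) ≟ᶠ x ]
  H′ e x = [ headO G (e , o′ e) ≟ᶠ x ]
  Tl e x = [ tailO G (e , o e) ≟ᶠ x ]

  defect : Edge G → Vertex G → ℤ
  defect e x = (chip o e x - chip o′ e x) - [ ε ≟ᶠ e ] * ∂e₁ x

  Translate : Set
  Translate = LinEquiv G (chipDivisor G T o -ᴰ chipDivisor G T o′) (pt G (headO G e₁) -ᴰ pt G (tailO G e₁))

  principal-if-edgewise : (v : Vertex G → ℤ) →
    (∀ e x → defect e x ≡ incidence G e x * (v (Graph.src G e) - v (Graph.tgt G e))) → Translate
  principal-if-edgewise v edgewise = v , λ x → begin
    (chipDivisor G T o x - chipDivisor G T o′ x) - ∂e₁ x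
      ≡⟨ cong (_-_ (chipDivisor G T o x - chipDivisor G T o′ x)) (sym (Σ-delta ε (λ _ → ∂e₁ x))) ⟩
    (Σℤ (λ e → chip o e x) - Σℤ (λ e → chip o′ e x)) - Σℤ (λ e → [ ε ≟ᶠ e ] * ∂e₁ x)
      ≡⟨ cong (_- Σℤ (λ e → [ ε ≟ᶠ e ] * ∂e₁ x)) (sym (Σ-- (λ e → chip o e x) (λ e → chip o′ e x))) ⟩
    Σℤ (λ e → chip o e x - chip o′ e x) - Σℤ (λ e → [ ε ≟ᶠ e ] * ∂e₁ x)
      ≡⟨ sym (Σ-- (λ e → chip o e x - chip o′ e x) (λ e → [ ε ≟ᶠ e ] * ∂e₁ x)) ⟩
    Σℤ (λ e → defect e x)
      ≡⟨ Σ-cong (λ e → edgewise e x) ⟩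
    Σℤ (λ e → incidence G e x * (v (Graph.src G e) - v (Graph.tgt G e)))
      ≡⟨ sym (Δ-as-edge-sum G v x) ⟩
    Δ G v x ∎

  module _ {f : Edge G} (f∉T : T f ≡ false) where

    cycle cycle′ : List (OEdge G)
    cycle = proj₁ (o-def f f∉T)
    cycle′ = proj₁ (o′-def f f∉T)

    through : Through f (o f) cycle
    through = record { f∉T = f∉T ; is-cycle = proj₁ (proj₂ (o-def f f∉T)) ; traverses-f = proj₁ (proj₂ (proj₂ (o-def f f∉T))) }

    through′ : Through f (o′ f) cycle′
    through′ = record { f∉T = f∉T ; is-cycle = proj₁ (proj₂ (o′-def f f∉T)) ; traverses-f = proj₁ (proj₂ (proj₂ (o′-def f f∉T))) }

    oriented : OrientedByData G ((ε , b) ∷ rest) cycle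
    oriented = proj₂ (proj₂ (proj₂ (o-def f f∉T)))

    oriented′ : OrientedByData G ((ε , not b) ∷ rest) cycle′
    oriented′ = proj₂ (proj₂ (proj₂ (o′-def f f∉T)))

    orientation-change : (ε ∈ map (edgeOf G) cycle × o′ f ≡ not (o f)) ⊎ (ε ∉ map (edgeOf G) cycle × o′ f ≡ o f)
    orientation-change with any? (ε ≟_) (map (edgeOf G) cycle)
    ... | yes ε∈C = inj₁ (ε∈C , flipped-if-ε-used through through′ oriented oriented′ ε∈C)
    ... | no ε∉C = inj₂ (ε∉C , kept-if-ε-unused through through′ oriented oriented′ ε∉C)

    chip-moves : o′ f ≡ not (o f) → ∀ x → [ headO G (f , o′ f) ≟ᶠ x ] ≡ [ tailO G (f , o f) ≟ᶠ x ]
    chip-moves flips x = trans (cong (λ c → [ headO G (f , c) ≟ᶠ x ]) flips) (cong [_≟ᶠ x ] (head-rev G (f , o f)))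

  incidence-reoriented : ∀ h e c x → incidence G e x * drop h (e , true)
    ≡ ([ tailO G (e , c) ≟ᶠ x ] - [ headO G (e , c) ≟ᶠ x ]) * drop h (e , c)
  incidence-reoriented h e true x = refl
  incidence-reoriented h e false x = trans (negate-both [ src e ≟ᶠ x ] [ tgt e ≟ᶠ x ] (drop h (e , true)))
    (cong (([ tgt e ≟ᶠ x ] - [ src e ≟ᶠ x ]) *_) (sym (drop-rev h (e , true))))
    where
    open Graph G
    negate-both : ∀ s t p → (s - t) * p ≡ (t - s) * - p
    negate-both = solve-∀

  module _ (ε∈T : T ε ≡ true) where

    drop-if-ε-used : ∀ {f} (f∉T : T f ≡ false) → ε ∈ map (edgeOf G) (cycle f∉T) → drop e₁ (f , o f) ≡ - (+ 1)
    drop-if-ε-used f∉T ε∈C with member⇒OnCycle (through f∉T) (first-datum-traversed b _ ε∈C (oriented f∉T))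
    ... | inj₁ (_ , drop≡-1) = drop≡-1
    ... | inj₂ e₁≡f = ⊥-elim (tree≢nontree T ε∈T f∉T (cong proj₁ e₁≡f))

    drop-if-ε-unused : ∀ {f} (f∉T : T f ≡ false) → ε ∉ map (edgeOf G) (cycle f∉T) → drop e₁ (f , o f) ≡ + 0
    drop-if-ε-unused f∉T ε∉C with tree-edge-use (through f∉T) e₁ ε∈T
    ... | along e₁∈C _ = ⊥-elim (ε∉C (∈-map⁺ (edgeOf G) e₁∈C))
    ... | against ē₁∈C _ = ⊥-elim (ε∉C (∈-map⁺ (edgeOf G) ē₁∈C))
    ... | unused _ drop≡0 = drop≡0

    edgewise-tree-edge : ∀ {e} → T e ≡ true → ∀ x →
      (+ 0 - + 0) - [ ε ≟ᶠ e ] * ∂e₁ x ≡ incidence G e x * drop e₁ (e , true)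
    edgewise-tree-edge {e} e∈T x with ε ≟ e
    ... | yes refl = sym (begin
      incidence G ε x * drop e₁ (ε , true)  ≡⟨ incidence-reoriented e₁ ε b x ⟩
      ([ tailO G e₁ ≟ᶠ x ] - [ headO G e₁ ≟ᶠ x ]) * drop e₁ e₁
        ≡⟨ cong (([ tailO G e₁ ≟ᶠ x ] - [ headO G e₁ ≟ᶠ x ]) *_) (trans (drop-tree e₁ e₁ ε∈T) (traversal-self G e₁)) ⟩
      ([ tailO G e₁ ≟ᶠ x ] - [ headO G e₁ ≟ᶠ x ]) * + 1  ≡⟨ on-ε [ headO G e₁ ≟ᶠ x ] [ tailO G e₁ ≟ᶠ x ] ⟩
      (+ 0 - + 0) - + 1 * ∂e₁ x ∎)
      where
      on-ε : ∀ h t → (t - h) * + 1 ≡ (+ 0 - + 0) - + 1 * (h - t)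
      on-ε = solve-∀
    ... | no ε≢e = trans (off-ε (∂e₁ x) (incidence G e x))
      (cong (incidence G e x *_) (sym (trans (drop-tree e₁ (e , true) e∈T) (traversal-off G e₁ (e , true) (ε≢e ∘ sym)))))
      where
      off-ε : ∀ p i → (+ 0 - + 0) - + 0 * p ≡ i * + 0
      off-ε = solve-∀

    edgewise-nontree-edge : ∀ {e} (e∉T : T e ≡ false) x →
      (H e x - H′ e x) - [ ε ≟ᶠ e ] * ∂e₁ x ≡ incidence G e x * drop e₁ (e , true)
    edgewise-nontree-edge {e} e∉T x = begin
      (H e x - H′ e x) - [ ε ≟ᶠ e ] * ∂e₁ x
        ≡⟨ cong (λ i → (H e x - H′ e x) - i * ∂e₁ x) (ind-neq (tree≢nontree T ε∈T e∉T)) ⟩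
      (H e x - H′ e x) - + 0 * ∂e₁ x     ≡⟨ no-correction (H e x - H′ e x) (∂e₁ x) ⟩
      H e x - H′ e x                    ≡⟨ chip-shift ⟩
      (Tl e x - H e x) * drop e₁ (e , o e) ≡⟨ sym (incidence-reoriented e₁ e (o e) x) ⟩
      incidence G e x * drop e₁ (e , true) ∎
      where
      no-correction : ∀ a p → a - + 0 * p ≡ a
      no-correction = solve-∀

      chip-shift : H e x - H′ e x ≡ (Tl e x - H e x) * drop e₁ (e , o e)
      chip-shift with orientation-change e∉T
      ... | inj₁ (ε∈C , flips) = begin
        H e x - H′ e x                        ≡⟨ cong (_-_ (H e x)) (chip-moves e∉T flips x) ⟩
        H e x - Tl e x                        ≡⟨ moved (H e x) (Tl e x) ⟩
        (Tl e x - H e x) * - (+ 1)            ≡⟨ cong ((Tl e x - H e x) *_) (sym (drop-if-ε-used e∉T ε∈C)) ⟩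
        (Tl e x - H e x) * drop e₁ (e , o e)  ∎
        where
        moved : ∀ h t → h - t ≡ (t - h) * - (+ 1)
        moved = solve-∀
      ... | inj₂ (ε∉C , keeps) = begin
        H e x - H′ e x                        ≡⟨ cong (λ c → H e x - [ headO G (e , c) ≟ᶠ x ]) keeps ⟩
        H e x - H e x                         ≡⟨ rests (H e x) (Tl e x - H e x) ⟩
        (Tl e x - H e x) * + 0                ≡⟨ cong ((Tl e x - H e x) *_) (sym (drop-if-ε-unused e∉T ε∉C)) ⟩
        (Tl e x - H e x) * drop e₁ (e , o e)  ∎
        where
        rests : ∀ h i → h - h ≡ i * + 0
        rests = solve-∀

    edgewise-ε-in-tree : ∀ e x → defect e x ≡ incidence G e x * drop e₁ (e , true)
    edgewise-ε-in-tree e x with T e in e-status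
    ... | true = edgewise-tree-edge e-status x
    ... | false = edgewise-nontree-edge e-status x

  module _ (ε∉T : T ε ≡ false) where

    -- the fundamental cycle of a non-tree edge f ≠ ε lies in T + f, so avoids ε
    ε-unused : ∀ {f} (f∉T : T f ≡ false) → ε ≢ f → ε ∉ map (edgeOf G) (cycle f∉T)
    ε-unused f∉T ε≢f ε∈C with ∈-map⁻ (edgeOf G) ε∈C
    ... | e′ , e′∈C , refl with All.lookup (edges-in-T+f (through f∉T)) e′∈C
    ...   | inj₁ ε∈T = tree≢nontree T ε∈T ε∉T refl
    ...   | inj₂ ε≡f = ε≢f ε≡f

    ε-reversed : o ε ≡ b × o′ ε ≡ not b
    ε-reversed with orientation-change ε∉T
    ... | inj₂ (ε∉C , _) = ⊥-elim (ε∉C (∈-map⁺ (edgeOf G) (Through.traverses-f (through ε∉T))))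
    ... | inj₁ (ε∈C , flips) = oε≡b , trans flips (cong not oε≡b)
      where
      oε≡b : o ε ≡ b
      oε≡b = cong proj₂ (unique-key (edgeOf G) (cycle ε∉T) (edges-distinct (through ε∉T))
        (Through.traverses-f (through ε∉T)) (first-datum-traversed b _ ε∈C (oriented ε∉T)) refl)

    edgewise-ε-outside-tree : ∀ e x → defect e x ≡ incidence G e x * (+ 0 - + 0)
    edgewise-ε-outside-tree e x with T e in e-status
    edgewise-ε-outside-tree e x | true =
      trans (cong (λ i → (+ 0 - + 0) - i * ∂e₁ x) (ind-neq (tree≢nontree T e-status ε∉T ∘ sym)))
            (rest-vanishes (∂e₁ x) (incidence G e x))
      where
      rest-vanishes : ∀ p i → (+ 0 - + 0) - + 0 * p ≡ i * (+ 0 - + 0)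
      rest-vanishes = solve-∀
    edgewise-ε-outside-tree e x | false with ε ≟ e
    ... | yes refl = begin
      ([ headO G (ε , o ε) ≟ᶠ x ] - [ headO G (ε , o′ ε) ≟ᶠ x ]) - + 1 * ∂e₁ x
        ≡⟨ cong₂ (λ c c′ → ([ headO G (ε , c) ≟ᶠ x ] - [ headO G (ε , c′) ≟ᶠ x ]) - + 1 * ∂e₁ x)
                 (proj₁ ε-reversed) (proj₂ ε-reversed) ⟩
      ([ headO G e₁ ≟ᶠ x ] - [ headO G (rev G e₁) ≟ᶠ x ]) - + 1 * ∂e₁ x
        ≡⟨ cong (λ t → ([ headO G e₁ ≟ᶠ x ] - [ t ≟ᶠ x ]) - + 1 * ∂e₁ x) (head-rev G e₁) ⟩
      ∂e₁ x - + 1 * ∂e₁ x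
        ≡⟨ moved (∂e₁ x) (incidence G ε x) ⟩
      incidence G ε x * (+ 0 - + 0) ∎
      where
      moved : ∀ p i → p - + 1 * p ≡ i * (+ 0 - + 0)
      moved = solve-∀
    ... | no ε≢e with orientation-change e-status
    ...   | inj₁ (ε∈C , _) = ⊥-elim (ε-unused e-status ε≢e ε∈C)
    ...   | inj₂ (_ , keeps) =
      trans (cong (λ c → (H e x - [ headO G (e , c) ≟ᶠ x ]) - + 0 * ∂e₁ x) keeps)
            (rests (H e x) (∂e₁ x) (incidence G e x))
      where
      rests : ∀ h p i → (h - h) - + 0 * p ≡ i * (+ 0 - + 0)
      rests = solve-∀

  translation : Translate
  translation with T ε in ε-status
  ... | true = principal-if-edgewise (potential e₁) (edgewise-ε-in-tree ε-status)
  ... | false = principal-if-edgewise (λ _ → + 0) (edgewise-ε-outside-tree ε-status)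

theorem5p8 : (G : Graph) → Connected G (λ _ → ⊤) →
    (Φ : Sub G) → IsForest G Φ →
    (e₁ : OEdge G) (rest : List (OEdge G)) → IsOrderingData G Φ (e₁ ∷ rest) →
    (T : Sub G) → IsSpanningTree G T →
    (o o′ : Edge G → Bool) →
    IsEdgeOrderingOrientation G (e₁ ∷ rest) T o →
    IsEdgeOrderingOrientation G (rev G e₁ ∷ rest) T o′ →
    LinEquiv G (chipDivisor G T o -ᴰ chipDivisor G T o′)
      (pt G (headO G e₁) -ᴰ pt G (tailO G e₁))
theorem5p8 G _ _ _ (ε , b) rest _ T T-tree o o′ o-def o′-def =
  Translation.translation G T T-tree ε b rest o o′ o-def o′-def
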